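{- Let $T$ be a string over an alphabet $\Sigma$ of length $n$, and let $1 \le i \le j < n$. Then \[ |\mathsf{MAW}(T[i..j+1]) \setminus \mathsf{MAW}(T[i..j])| \le \sigma' + d, \] where $d = j-i+1$ and $\sigma'$ is the number of distinct characters occurring in $T[i..j]$.
   Context: For a string $W$, $W[a..b]$ denotes the substring from position $a$ to position $b$. A string $w$ is present in $W$ if it occurs in $W$ (the empty string is always present) and absent otherwise. A string $w\in\Sigma^\ast$ is a minimal absent word (MAW) of $W$ if $w$ is absent from $W$ and every proper substring of $w$ is present in $W$; $\mathsf{MAW}(W)$ is the set of all MAWs of $W$. -}

module Defs where

open import Data.Nat using (ℕ; suc; _∸_; _<_)
open import Data.List using (List; _++_; take; drop; length; deduplicate)
open import Data.Product using (∃; _×_)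
open import Relation.Nullary using (¬_)
open import Relation.Binary.PropositionalEquality using (_≡_)
open import Relation.Binary.Definitions using (DecidableEquality)

Present : {Σ : Set} → List Σ → List Σ → Set
Present w W = ∃ λ u → ∃ λ v → u ++ w ++ v ≡ W

Absent : {Σ : Set} → List Σ → List Σ → Set
Absent w W = ¬ Present w W

IsMAW : {Σ : Set} → List Σ → List Σ → Set
IsMAW W w = Absent w W × (∀ x → Present x w → length x < length w → Present x W)

-- T[i..j] with 1-based inclusive indices: length j - i + 1 starting at position i
substr : {Σ : Set} → List Σ → ℕ → ℕ → List Σ
substr T i j = take (suc j ∸ i) (drop (i ∸ 1) T)

distinctChars : {Σ : Set} → DecidableEquality Σ → List Σ → ℕ
distinctChars _≟_ W = length (deduplicate _≟_ W)

module Submission where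

-- Write S = T[i..j], so that T[i..j+1] = S c. A MAW w of S c that is not a MAW of S has
-- the form a u b with a u and u b present in S c, and one of them absent from S (otherwise
-- w would already be a MAW of S). If a u is absent from S, it is a suffix of S c and w is
-- determined by its last letter b, which is c or occurs in S: at most σ' + 1 words. Otherwise
-- u b is absent from S, hence a suffix of S c, so b = c, u is a suffix of S, and a u occurs in
-- S but not as a suffix of S; then w is determined by the end position of such an occurrence,
-- one of |S| - 1 positions. In both cases two words with the same key are suffixes of a common
-- word, so if they differed the shorter a u would be a suffix of the longer one's u, and hence
-- present where it must be absent.

open import Defs
open import Data.Nat using (ℕ; suc; _+_; _∸_; _≤_; _<_; z≤n; s≤s)
open import Data.Nat.Properties
  using (≤-trans; ≤-reflexive; <⇒≤; <⇒≱; <-irrefl; <-cmp; n<1+n; m<m+n; +-suc; m≤n⇒m≤1+n; m≤n⇒m⊓n≡m;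
         ∸-monoˡ-≤; ∸-monoˡ-<; +-∸-assoc; m+[n∸m]≡n; m<n⇒0<n∸m)
open import Data.Fin using (fromℕ<)
open import Data.Fin.Properties using (toℕ-fromℕ<)
open import Data.List
  using (List; []; _∷_; _++_; [_]; _∷ʳ_; length; map; upTo; take; drop; lookup; deduplicate;
         initLast; _∷ʳ′_)
open import Data.List.Properties
  using (++-assoc; ++-identityʳ; ++-cancelʳ; ∷-injectiveʳ; ∷ʳ-injective; ∷ʳ-injectiveˡ; ∷ʳ-++;
         length-++; length-++-≤ʳ; length-map; length-upTo; length-take; length-drop; take-suc)
open import Data.List.Membership.Propositional using (_∈_)
open import Data.List.Membership.Propositional.Properties
  using (∈-++⁺ˡ; ∈-++⁺ʳ; ∈-upTo⁺; ∈-deduplicate⁺; ∈-map⁺)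
open import Data.List.Relation.Unary.Any using (here; there)
open import Data.List.Relation.Unary.All using (All; []; _∷_)
import Data.List.Relation.Unary.All as All
open import Data.List.Relation.Unary.AllPairs using ([]; _∷_)
open import Data.List.Relation.Unary.Unique.Propositional using (Unique)
open import Data.List.Relation.Binary.Infix.Heterogeneous using (Infix; MkView; toView; fromView)
open import Data.List.Relation.Binary.Infix.Heterogeneous.Properties using (infix?)
open import Data.List.Relation.Binary.Pointwise using (Pointwise-≡⇒≡; ≡⇒Pointwise-≡)
open import Data.Product using (_×_; _,_; ∃; ∃₂; proj₁; proj₂)
open import Data.Sum using (_⊎_; inj₁; inj₂; [_,_]′)
open import Data.Empty using (⊥-elim)
open import Relation.Nullary using (¬_; Dec; yes; no)
open import Relation.Nullary.Decidable using (map′)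
open import Relation.Binary.Definitions using (DecidableEquality; tri<; tri≈; tri>)
open import Relation.Binary.PropositionalEquality
  using (_≡_; _≢_; refl; sym; trans; cong; cong₂; subst; module ≡-Reasoning)

private
  variable
    A B : Set
    a b c : A
    u v w x y z W : List A

∈-remove : (ys : List B) {y : B} → y ∈ ys →
           ∃ λ ys′ → length ys ≡ suc (length ys′) × (∀ {y′} → y′ ∈ ys → y′ ≢ y → y′ ∈ ys′)
∈-remove (y ∷ ys) (here refl) =
  ys , refl , λ { (here refl) y≢y → ⊥-elim (y≢y refl) ; (there y′∈ys) _ → y′∈ys }
∈-remove (y ∷ ys) (there y∈ys) with ys′ , len , keep ← ∈-remove ys y∈ys =
  y ∷ ys′ , cong suc len ,
  λ { (here refl) _ → here refl ; (there y′∈ys) y′≢y → there (keep y′∈ys y′≢y) }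

length-≤-by-injection : (R : A → B → Set) → (∀ {x x′ y} → R x y → R x′ y → x ≡ x′) →
                        ∀ {xs} ys → Unique xs → All (λ x → ∃ λ y → y ∈ ys × R x y) xs →
                        length xs ≤ length ys
length-≤-by-injection R R-injective ys [] [] = z≤n
length-≤-by-injection R R-injective {x ∷ xs} ys (x≢xs ∷ unique) ((y , y∈ys , xRy) ∷ images)
  with ys′ , len , keep ← ∈-remove ys y∈ys =
  subst (suc (length xs) ≤_) (sym len)
    (s≤s (length-≤-by-injection R R-injective ys′ unique (All.zipWith avoid-y (x≢xs , images))))
  where
  avoid-y : ∀ {x′} → x ≢ x′ × (∃ λ y′ → y′ ∈ ys × R x′ y′) → ∃ λ y′ → y′ ∈ ys′ × R x′ y′
  avoid-y (x≢x′ , y′ , y′∈ys , x′Ry′) =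
    y′ , keep y′∈ys (λ { refl → x≢x′ (R-injective xRy x′Ry′) }) , x′Ry′

Suffix : List A → List A → Set
Suffix x W = ∃ λ P → P ++ x ≡ W

present-[] : (W : List A) → Present [] W
present-[] W = [] , W , refl

present-trans : Present x y → Present y z → Present x z
present-trans {x = x} (u , v , refl) (u′ , v′ , refl) = u′ ++ u , v ++ v′ , (begin
  (u′ ++ u) ++ x ++ v ++ v′   ≡⟨ ++-assoc u′ u _ ⟩
  u′ ++ u ++ x ++ v ++ v′     ≡⟨ cong (λ t → u′ ++ u ++ t) (++-assoc x v v′) ⟨
  u′ ++ u ++ (x ++ v) ++ v′   ≡⟨ cong (u′ ++_) (++-assoc u (x ++ v) v′) ⟨
  u′ ++ (u ++ x ++ v) ++ v′   ∎)
  where open ≡-Reasoning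

present-∷ʳ : Present x W → Present x (W ∷ʳ c)
present-∷ʳ {x = x} {c = c} (u , v , refl) = u , v ∷ʳ c , (begin
  u ++ x ++ v ++ [ c ]     ≡⟨ cong (u ++_) (++-assoc x v [ c ]) ⟨
  u ++ (x ++ v) ++ [ c ]   ≡⟨ ++-assoc u (x ++ v) [ c ] ⟨
  (u ++ x ++ v) ++ [ c ]   ∎)
  where open ≡-Reasoning

∈-present : Present x W → a ∈ x → a ∈ W
∈-present (u , v , refl) a∈x = ∈-++⁺ʳ u (∈-++⁺ˡ a∈x)

infix⇒present : Infix _≡_ x W → Present x W
infix⇒present p with MkView u x≋ v ← toView p = u , v , cong (λ t → u ++ t ++ v) (Pointwise-≡⇒≡ x≋)

present⇒infix : Present x W → Infix _≡_ x W
present⇒infix (u , v , refl) = fromView (MkView u (≡⇒Pointwise-≡ refl) v)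

present? : DecidableEquality A → (x W : List A) → Dec (Present x W)
present? _≟_ x W = map′ infix⇒present present⇒infix (infix? _≟_ x W)

suffix⇒present : Suffix x W → Present x W
suffix⇒present {x = x} (P , refl) = P , [] , cong (P ++_) (++-identityʳ x)

suffix-trans : Suffix x y → Suffix y z → Suffix x z
suffix-trans {x = x} (P , refl) (Q , refl) = Q ++ P , ++-assoc Q P x

suffix-∷ʳ : Suffix x W → Suffix (x ∷ʳ c) (W ∷ʳ c)
suffix-∷ʳ {x = x} {c = c} (P , refl) = P , sym (++-assoc P x [ c ])

suffix-∷ʳ⁻ : Suffix (x ∷ʳ b) (W ∷ʳ c) → b ≡ c × Suffix x W
suffix-∷ʳ⁻ {x = x} {b = b} {W = W} (P , eq)
  with Px≡W , b≡c ← ∷ʳ-injective (P ++ x) W (trans (++-assoc P x [ b ]) eq) = b≡c , P , Px≡W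

present-∷ʳ-split : Present x (W ∷ʳ c) → Present x W ⊎ Suffix x (W ∷ʳ c)
present-∷ʳ-split {x = x} {W = W} (u , v , eq) with initLast v
... | [] = inj₂ (u , trans (cong (u ++_) (sym (++-identityʳ x))) eq)
... | v′ ∷ʳ′ d = inj₁ (u , v′ , ∷ʳ-injectiveˡ (u ++ x ++ v′) W (begin
  (u ++ x ++ v′) ++ [ d ]    ≡⟨ ++-assoc u (x ++ v′) [ d ] ⟩
  u ++ (x ++ v′) ++ [ d ]    ≡⟨ cong (u ++_) (++-assoc x v′ [ d ]) ⟩
  u ++ x ++ v′ ∷ʳ d          ≡⟨ eq ⟩
  W ∷ʳ _                     ∎))
  where open ≡-Reasoning

absent-present-∷ʳ⇒suffix : Present x (W ∷ʳ c) → Absent x W → Suffix x (W ∷ʳ c)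
absent-present-∷ʳ⇒suffix occ x∉W with present-∷ʳ-split occ
... | inj₁ x∈W = ⊥-elim (x∉W x∈W)
... | inj₂ suffix = suffix

present-∷ʳ⁻ : Present (x ∷ʳ b) (W ∷ʳ c) → Present x W
present-∷ʳ⁻ {x = x} {b = b} occ with present-∷ʳ-split occ
... | inj₁ xb∈W = present-trans ([] , [ b ] , refl) xb∈W
... | inj₂ suffix = suffix⇒present (proj₂ (suffix-∷ʳ⁻ suffix))

suffix-of-longer : (P Q : List A) → P ++ x ≡ Q ++ z → length x ≤ length z → Suffix x z
suffix-of-longer P [] eq _ = P , eq
suffix-of-longer {x = x} {z = z} [] (q ∷ Q) refl x≤z = ⊥-elim (<⇒≱ (s≤s (length-++-≤ʳ z {Q})) x≤z)
suffix-of-longer (p ∷ P) (q ∷ Q) eq x≤z = suffix-of-longer P Q (∷-injectiveʳ eq) x≤z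

++-cancel-length : (P Q : List A) → P ++ x ≡ Q ++ z → length x ≡ length z → P ≡ Q × x ≡ z
++-cancel-length {x = x} {z = z} P Q eq |x|≡|z| with suffix-of-longer P Q eq (≤-reflexive |x|≡|z|)
... | [] , refl = ++-cancelʳ x P Q eq , refl
... | d ∷ D , refl = ⊥-elim (<-irrefl |x|≡|z| (s≤s (length-++-≤ʳ x {D})))

suffix-trichotomy : Suffix (a ∷ u) W → Suffix (b ∷ v) W →
                    Suffix (a ∷ u) v ⊎ a ∷ u ≡ b ∷ v ⊎ Suffix (b ∷ v) u
suffix-trichotomy {a = a} {u} {b = b} {v} (P , refl) (Q , eq) with <-cmp (length u) (length v)
... | tri< u<v _ _ = inj₁ (suffix-of-longer P (Q ∷ʳ b) (trans (sym eq) (sym (∷ʳ-++ Q b v))) u<v)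
... | tri≈ _ |u|≡|v| _ = inj₂ (inj₁ (proj₂ (++-cancel-length P Q (sym eq) (cong suc |u|≡|v|))))
... | tri> _ _ v<u = inj₂ (inj₂ (suffix-of-longer Q (P ∷ʳ a) (trans eq (sym (∷ʳ-++ P a u))) v<u))

proper-infix : Present x (a ∷ u ∷ʳ b) → length x < length (a ∷ u ∷ʳ b) →
               Present x (a ∷ u) ⊎ Present x (u ∷ʳ b)
proper-infix {x = x} {a = a} {u} ([] , v , eq) x<w with initLast v
... | [] = ⊥-elim (<-irrefl (cong length (trans (sym (++-identityʳ x)) eq)) x<w)
... | v′ ∷ʳ′ d = inj₁ ([] , v′ , ∷ʳ-injectiveˡ (x ++ v′) (a ∷ u) (trans (++-assoc x v′ [ d ]) eq))
proper-infix (_ ∷ p , v , eq) _ = inj₂ (p , v , ∷-injectiveʳ eq)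

maw-intro : Absent (a ∷ u ∷ʳ b) W → Present (a ∷ u) W → Present (u ∷ʳ b) W → IsMAW W (a ∷ u ∷ʳ b)
maw-intro absent init∈W tail∈W = absent , λ x occ shorter →
  [ (λ x∈init → present-trans x∈init init∈W) , (λ x∈tail → present-trans x∈tail tail∈W) ]′
    (proper-infix occ shorter)

maw-letter : Absent [ a ] W → IsMAW W [ a ]
maw-letter {W = W} absent = absent , λ { [] _ _ → present-[] W ; (_ ∷ _) _ (s≤s ()) }

maw-init-present : IsMAW W (u ∷ʳ b) → Present u W
maw-init-present {u = u} {b = b} (_ , minimal) =
  minimal u ([] , [ b ] , refl) (subst (length u <_) (sym (length-++ u)) (m<m+n (length u) (s≤s z≤n)))

maw-tail-present : IsMAW W (a ∷ u) → Present u W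
maw-tail-present {a = a} {u = u} (_ , minimal) =
  minimal u ([ a ] , [] , cong (a ∷_) (++-identityʳ u)) (n<1+n (length u))

module NewMAWs (_≟_ : DecidableEquality A) (S : List A) (c : A) where

  NewMAW : List A → Set
  NewMAW w = IsMAW (S ∷ʳ c) w × ¬ IsMAW S w

  LeftNew : List A → A → Set
  LeftNew w b = ∃₂ λ a u → w ≡ a ∷ u ∷ʳ b × Suffix (a ∷ u) (S ∷ʳ c) × Absent (a ∷ u) S × Present u S

  -- The key e locates an occurrence of a ∷ u in S that is followed by e + 1 letters.
  RightNew : List A → ℕ → Set
  RightNew w e = ∃₂ λ a u → ∃₂ λ X r →
    w ≡ a ∷ u ∷ʳ c × Suffix (a ∷ u) X × X ++ r ≡ S × length r ≡ suc e × Suffix u S × Absent w (S ∷ʳ c)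

  Key : List A → ℕ ⊎ A → Set
  Key w (inj₁ e) = RightNew w e
  Key w (inj₂ b) = LeftNew w b

  keys : List (ℕ ⊎ A)
  keys = map inj₂ (c ∷ deduplicate _≟_ S) ++ map inj₁ (upTo (length S ∸ 1))

  Keyed : List A → Set
  Keyed w = ∃ λ k → k ∈ keys × Key w k

  leftNew-injective : LeftNew w b → LeftNew x b → w ≡ x
  leftNew-injective {b = b} (a , u , refl , s , au∉S , u∈S) (a′ , u′ , refl , s′ , a′u′∉S , u′∈S)
    with suffix-trichotomy s s′
  ... | inj₁ s″ = ⊥-elim (au∉S (present-trans (suffix⇒present s″) u′∈S))
  ... | inj₂ (inj₁ eq) = cong (_∷ʳ b) eq
  ... | inj₂ (inj₂ s″) = ⊥-elim (a′u′∉S (present-trans (suffix⇒present s″) u∈S))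

  rightNew-injective : ∀ {e} → RightNew w e → RightNew x e → w ≡ x
  rightNew-injective (a , u , X , r , refl , s , o , l , u⊑S , w∉Sc)
                     (a′ , u′ , X′ , r′ , refl , s′ , o′ , l′ , u′⊑S , x∉Sc)
    with refl , _ ← ++-cancel-length X X′ (trans o (sym o′)) (trans l (sym l′))
    with suffix-trichotomy s s′
  ... | inj₁ s″ = ⊥-elim (w∉Sc (suffix⇒present (suffix-∷ʳ (suffix-trans s″ u′⊑S))))
  ... | inj₂ (inj₁ eq) = cong (_∷ʳ c) eq
  ... | inj₂ (inj₂ s″) = ⊥-elim (x∉Sc (suffix⇒present (suffix-∷ʳ (suffix-trans s″ u⊑S))))

  key-injective : ∀ {k} → Key w k → Key x k → w ≡ x
  key-injective {k = inj₁ e} = rightNew-injective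
  key-injective {k = inj₂ b} = leftNew-injective

  length-keys : 0 < length S → length keys ≡ distinctChars _≟_ S + length S
  length-keys 0<S = begin
    length keys                                ≡⟨ length-++ (map inj₂ (c ∷ letters)) ⟩
    length (map inj₂ (c ∷ letters)) + length (map inj₁ ends)
                                               ≡⟨ cong₂ _+_ (length-map inj₂ (c ∷ letters)) (length-map inj₁ ends) ⟩
    suc (length letters) + length ends         ≡⟨ cong (suc (length letters) +_) (length-upTo (length S ∸ 1)) ⟩
    suc (length letters + (length S ∸ 1))      ≡⟨ +-suc (length letters) (length S ∸ 1) ⟨
    length letters + suc (length S ∸ 1)        ≡⟨ cong (length letters +_) (m+[n∸m]≡n 0<S) ⟩
    length letters + length S                  ∎
    where
    open ≡-Reasoning
    letters = deduplicate _≟_ S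
    ends = upTo (length S ∸ 1)

  newMAW-shape : NewMAW w → ∃₂ λ a u → ∃ λ b → w ≡ a ∷ u ∷ʳ b × IsMAW (S ∷ʳ c) w ×
                 (Absent (a ∷ u) S ⊎ Present (a ∷ u) S × Absent (u ∷ʳ b) S)
  newMAW-shape {w = []} ((absent , _) , _) = ⊥-elim (absent (present-[] _))
  newMAW-shape {w = a ∷ v} (maw@(absent , _) , not-old) with initLast v
  ... | [] = ⊥-elim (not-old (maw-letter (λ occ → absent (present-∷ʳ occ))))
  ... | u ∷ʳ′ b with present? _≟_ (a ∷ u) S | present? _≟_ (u ∷ʳ b) S
  ...   | no au∉S | _ = a , u , b , refl , maw , inj₁ au∉S
  ...   | yes au∈S | no ub∉S = a , u , b , refl , maw , inj₂ (au∈S , ub∉S)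
  ...   | yes au∈S | yes ub∈S = ⊥-elim (not-old (maw-intro (λ occ → absent (present-∷ʳ occ)) au∈S ub∈S))

  leftNew-keyed : IsMAW (S ∷ʳ c) (a ∷ u ∷ʳ b) → Absent (a ∷ u) S → Keyed (a ∷ u ∷ʳ b)
  leftNew-keyed {a = a} {u} {b} maw au∉S =
    inj₂ b , ∈-++⁺ˡ (∈-map⁺ inj₂ (last-letter (present-∷ʳ-split ub∈Sc))) ,
    a , u , refl , absent-present-∷ʳ⇒suffix (maw-init-present maw) au∉S , au∉S , present-∷ʳ⁻ ub∈Sc
    where
    ub∈Sc : Present (u ∷ʳ b) (S ∷ʳ c)
    ub∈Sc = maw-tail-present maw

    last-letter : Present (u ∷ʳ b) S ⊎ Suffix (u ∷ʳ b) (S ∷ʳ c) → b ∈ c ∷ deduplicate _≟_ S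
    last-letter (inj₁ ub∈S) = there (∈-deduplicate⁺ _≟_ (∈-present ub∈S (∈-++⁺ʳ u (here refl))))
    last-letter (inj₂ ub⊑Sc) = here (proj₁ (suffix-∷ʳ⁻ ub⊑Sc))

  rightNew-keyed : IsMAW (S ∷ʳ c) (a ∷ u ∷ʳ b) → Present (a ∷ u) S → Absent (u ∷ʳ b) S →
                   Keyed (a ∷ u ∷ʳ b)
  rightNew-keyed {a = a} {u} maw (q , [] , occ) ub∉S
    with refl , _ ← suffix-∷ʳ⁻ (absent-present-∷ʳ⇒suffix (maw-tail-present maw) ub∉S) =
    ⊥-elim (proj₁ maw (suffix⇒present (suffix-∷ʳ au⊑S)))
    where
    au⊑S : Suffix (a ∷ u) S
    au⊑S = q , trans (cong (q ++_) (sym (++-identityʳ (a ∷ u)))) occ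
  rightNew-keyed {a = a} {u} maw (q , d ∷ r , occ) ub∉S
    with refl , u⊑S ← suffix-∷ʳ⁻ (absent-present-∷ʳ⇒suffix (maw-tail-present maw) ub∉S) =
    inj₁ (length r) , ∈-++⁺ʳ _ (∈-map⁺ inj₁ (∈-upTo⁺ (∸-monoˡ-≤ 1 2+r≤S))) ,
    a , u , q ++ a ∷ u , d ∷ r , refl , (q , refl) , trans (++-assoc q (a ∷ u) (d ∷ r)) occ , refl ,
    u⊑S , proj₁ maw
    where
    2+r≤S : suc (suc (length r)) ≤ length S
    2+r≤S = ≤-trans (s≤s (length-++-≤ʳ (d ∷ r) {u}))
                    (subst (λ t → length (a ∷ u ++ d ∷ r) ≤ length t) occ
                           (length-++-≤ʳ (a ∷ u ++ d ∷ r) {q}))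

  newMAW-keyed : NewMAW w → Keyed w
  newMAW-keyed new with newMAW-shape new
  ... | _ , _ , _ , refl , maw , inj₁ au∉S = leftNew-keyed maw au∉S
  ... | _ , _ , _ , refl , maw , inj₂ (au∈S , ub∉S) = rightNew-keyed maw au∈S ub∉S

  length-newMAWs-≤ : 0 < length S → ∀ {L} → Unique L → All NewMAW L →
                     length L ≤ distinctChars _≟_ S + length S
  length-newMAWs-≤ 0<S unique new =
    ≤-trans (length-≤-by-injection Key key-injective keys unique (All.map newMAW-keyed new))
            (≤-reflexive (length-keys 0<S))

take-suc-∷ʳ : (xs : List A) {n : ℕ} → n < length xs → ∃ λ c → take (suc n) xs ≡ take n xs ∷ʳ c
take-suc-∷ʳ xs n<xs =
  lookup xs k , subst (λ m → take (suc m) xs ≡ take m xs ∷ʳ lookup xs k) (toℕ-fromℕ< n<xs) (take-suc xs k)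
  where k = fromℕ< n<xs

length-substr : (T : List A) (i : ℕ) {j : ℕ} → j < length T → length (substr T i j) ≡ suc j ∸ i
length-substr T i {j} j<T = trans (length-take (suc j ∸ i) _) (m≤n⇒m⊓n≡m (fits i))
  where
  fits : ∀ k → suc j ∸ k ≤ length (drop (k ∸ 1) T)
  fits 0 = j<T
  fits (suc k) = subst (j ∸ k ≤_) (sym (length-drop k T)) (∸-monoˡ-≤ k (<⇒≤ j<T))

substr-∷ʳ : (T : List A) {i j : ℕ} → 1 ≤ i → i ≤ suc j → j < length T →
            ∃ λ c → substr T i (suc j) ≡ substr T i j ∷ʳ c
substr-∷ʳ T {suc i} {j} _ (s≤s i≤j) j<T
  with c , eq ← take-suc-∷ʳ (drop i T) (subst (j ∸ i <_) (sym (length-drop i T)) (∸-monoˡ-< j<T i≤j)) =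
  c , trans (cong (λ m → take m (drop i T)) (+-∸-assoc 1 i≤j)) eq

lemma11 : {Σ : Set} (_≟_ : DecidableEquality Σ) (T : List Σ) (i j : ℕ) →
          1 ≤ i → i ≤ j → j < length T →
          (L : List (List Σ)) → Unique L →
          All (λ w → IsMAW (substr T i (suc j)) w × ¬ IsMAW (substr T i j) w) L →
          length L ≤ distinctChars _≟_ (substr T i j) + (suc j ∸ i)
lemma11 _≟_ T i j 1≤i i≤j j<T L unique new
  with c , extend ← substr-∷ʳ T 1≤i (m≤n⇒m≤1+n i≤j) j<T =
  subst (λ n → length L ≤ distinctChars _≟_ S + n) |S|≡d
    (length-newMAWs-≤ (subst (0 <_) (sym |S|≡d) (m<n⇒0<n∸m (s≤s i≤j))) unique
      (subst (λ W → All (λ w → IsMAW W w × ¬ IsMAW S w) L) extend new))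
  where
  S = substr T i j
  open NewMAWs _≟_ S c
  |S|≡d : length S ≡ suc j ∸ i
  |S|≡d = length-substr T i j<T
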